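{- Let $G$ be a finite simple graph, $A_1,A_2$ disjoint subsets of $V(G)$, and $G^*$ the graph obtained by toggling all pairs between $A_1$ and $A_2$, with closed neighborhood matrices $N$ and $N^*$. Suppose $A_1$ and $A_2$ are AO sets in $G$ and $A_2$ is $\overline{\mathbf{x}_{A_1}}$-AO in $G$. Then for every pattern $\mathbf{p}$, $N^*\mathbf{p}=\mathbf{1}$ if and only if $N\mathbf{p}=\overline{\mathbf{x}_{A_1}}$ or $N\mathbf{p}=\overline{\mathbf{x}_{A_2}}$. Moreover, $A_1$ and $A_2$ are HO in $G^*$ and $\nu(G^*)=\nu(G)+1$.
   Context: For a graph $H$ with vertex set $V=\{v_1,\dots,v_n\}$, $N(H)$ is the closed neighborhood matrix over $\mathbb{Z}_2$ (entry $(i,j)$ is $1$ iff $i=j$ or $v_iv_j$ is an edge), $\nu(H)=\dim\ker N(H)$. Given disjoint $A_1,A_2\subseteq V(G)$, $G^*$ is obtained from $G$ by, for every $u\in A_1$, $v\in A_2$, adding the edge $uv$ if $u,v$ are non-adjacent and removing it if they are adjacent; $N=N(G)$, $N^*=N(G^*)$. Subsets $A$ are identified with characteristic vectors $\mathbf{x}_A$; $\mathbf{x}\cdot\mathbf{y}=\mathbf{x}^t\mathbf{y}$ over $\mathbb{Z}_2$; $\mathbf{1}$ is the all-ones vector, $\overline{\mathbf{x}}:=\mathbf{x}+\mathbf{1}$. In a graph $H$ with matrix $M$: a pattern $\mathbf{p}$ solves configuration $\mathbf{c}$ if $M\mathbf{p}=\mathbf{c}$; $\mathbf{c}$ (or a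 set $A$ via $\mathbf{x}_A$) is solvable if some pattern solves it; $\mathbf{1}$ is always solvable. A set $A$ is HO if it is not solvable. For solvable $A$ and solvable $\mathbf{c}$, $A$ is $\mathbf{c}$-AO if $\mathbf{x}_A\cdot\mathbf{p}=1$ for all solving patterns $\mathbf{p}$ of $\mathbf{c}$, and $\mathbf{c}$-NO if $\mathbf{x}_A\cdot\mathbf{p}=0$ for all of them; AO and NO mean $\mathbf{1}$-AO and $\mathbf{1}$-NO. -}

module Defs where

open import Data.Nat using (ℕ; zero; suc)
open import Data.Fin using (Fin; zero; suc; _≟_)
open import Data.Bool using (Bool; true; false; _∧_; _∨_; _xor_; not)
open import Data.Bool.Properties using (∧-comm; ∨-comm)
open import Data.Product using (Σ; _×_; _,_)
open import Relation.Nullary using (¬_)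
open import Relation.Nullary.Decidable using (⌊_⌋)
open import Relation.Binary.PropositionalEquality using (_≡_; refl; cong; cong₂; trans)

-- Z₂ is modelled by Bool: addition = _xor_, multiplication = _∧_.

-- Vectors in Z₂^n (patterns, configurations, characteristic vectors of subsets
-- of the vertex set {0,…,n-1}) and n×m matrices over Z₂.
Vec₂ : ℕ → Set
Vec₂ n = Fin n → Bool

Mat₂ : ℕ → Set
Mat₂ n = Fin n → Fin n → Bool

Σ₂ : ∀ {n} → (Fin n → Bool) → Bool
Σ₂ {zero} f = false
Σ₂ {suc n} f = f zero xor Σ₂ (λ i → f (suc i))

_·_ : ∀ {n} → Vec₂ n → Vec₂ n → Bool
x · y = Σ₂ (λ i → x i ∧ y i)

_*ᵥ_ : ∀ {n} → Mat₂ n → Vec₂ n → Vec₂ n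
(M *ᵥ p) i = Σ₂ (λ j → M i j ∧ p j)

𝟏 : ∀ {n} → Vec₂ n
𝟏 i = true

‾ : ∀ {n} → Vec₂ n → Vec₂ n
‾ x i = x i xor true

𝟎 : ∀ {n} → Vec₂ n
𝟎 i = false

record Graph (n : ℕ) : Set where
  field
    adj    : Fin n → Fin n → Bool
    adj-sym    : ∀ i j → adj i j ≡ adj j i
    adj-irrefl : ∀ i → adj i i ≡ false
open Graph public

N : ∀ {n} → Graph n → Mat₂ n
N H i j = ⌊ i ≟ j ⌋ ∨ adj H i j

Disjoint : ∀ {n} → Vec₂ n → Vec₂ n → Set
Disjoint A₁ A₂ = ∀ i → A₁ i ∧ A₂ i ≡ false

cross : ∀ {n} → Vec₂ n → Vec₂ n → Fin n → Fin n → Bool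
cross A₁ A₂ u v = (A₁ u ∧ A₂ v) ∨ (A₂ u ∧ A₁ v)

private
  cross-sym : ∀ {n} (A₁ A₂ : Vec₂ n) u v → cross A₁ A₂ u v ≡ cross A₁ A₂ v u
  cross-sym A₁ A₂ u v =
    trans (∨-comm (A₁ u ∧ A₂ v) (A₂ u ∧ A₁ v))
          (cong₂ _∨_ (∧-comm (A₂ u) (A₁ v)) (∧-comm (A₁ u) (A₂ v)))

  cross-diag : ∀ {n} (A₁ A₂ : Vec₂ n) → Disjoint A₁ A₂ → ∀ u → cross A₁ A₂ u u ≡ false
  cross-diag A₁ A₂ d u rewrite d u | ∧-comm (A₂ u) (A₁ u) | d u = refl

toggle : ∀ {n} (G : Graph n) (A₁ A₂ : Vec₂ n) → Disjoint A₁ A₂ → Graph n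
toggle G A₁ A₂ d = record
  { adj    = λ u v → adj G u v xor cross A₁ A₂ u v
  ; adj-sym    = λ u v → cong₂ _xor_ (Graph.adj-sym G u v) (cross-sym A₁ A₂ u v)
  ; adj-irrefl = λ u → cong₂ _xor_ (Graph.adj-irrefl G u) (cross-diag A₁ A₂ d u)
  }

_≈_ : ∀ {n} → Vec₂ n → Vec₂ n → Set
x ≈ y = ∀ i → x i ≡ y i

Solves : ∀ {n} → Mat₂ n → Vec₂ n → Vec₂ n → Set
Solves M p c = (M *ᵥ p) ≈ c

Solvable : ∀ {n} → Mat₂ n → Vec₂ n → Set
Solvable M c = Σ (Vec₂ _) (λ p → Solves M p c)

HO : ∀ {n} → Mat₂ n → Vec₂ n → Set
HO M A = ¬ Solvable M A

_-AO : ∀ {n} → Vec₂ n → Mat₂ n → Vec₂ n → Set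
(c -AO) M A = Solvable M A × Solvable M c × (∀ p → Solves M p c → (A · p) ≡ true)

_-NO : ∀ {n} → Vec₂ n → Mat₂ n → Vec₂ n → Set
(c -NO) M A = Solvable M A × Solvable M c × (∀ p → Solves M p c → (A · p) ≡ false)

AO : ∀ {n} → Mat₂ n → Vec₂ n → Set
AO = 𝟏 -AO

NO : ∀ {n} → Mat₂ n → Vec₂ n → Set
NO = 𝟏 -NO

lincomb : ∀ {n k} → (Fin k → Bool) → (Fin k → Vec₂ n) → Vec₂ n
lincomb c b i = Σ₂ (λ j → c j ∧ b j i)

InKer : ∀ {n} → Mat₂ n → Vec₂ n → Set
InKer M x = (M *ᵥ x) ≈ 𝟎

IsKerBasis : ∀ {n} → Mat₂ n → (k : ℕ) → (Fin k → Vec₂ n) → Set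
IsKerBasis {n} M k b =
    (∀ j → InKer M (b j))
  × (∀ (c : Fin k → Bool) → lincomb c b ≈ 𝟎 → ∀ j → c j ≡ false)
  × (∀ (x : Vec₂ n) → InKer M x → Σ (Fin k → Bool) (λ c → lincomb c b ≈ x))

HasNullity : ∀ {n} → Mat₂ n → ℕ → Set
HasNullity M k = Σ (Fin k → Vec₂ _) (IsKerBasis M k)

{-# OPTIONS --safe #-}
-- Let q₁, q₂ solve A₁, A₂ in G and write N = N(G). As N is symmetric, x_A · p = q · N p whenever
-- N q = x_A, and as N has unit diagonal, q · N q = q · 𝟏; so the three hypotheses say exactly that
-- q_i · A_j = δ_ij. Toggling adds the matrix A₁A₂ᵗ + A₂A₁ᵗ, hence N* p = update (N p) with
-- update c = c + (q₂ · c) A₁ + (q₁ · c) A₂. Every value w of update has q₁ · w = q₂ · w, which excludes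
-- A₁ and A₂; update c = 𝟏 exactly for c = ‾A₁, ‾A₂; and update c = 0 exactly for the multiples of
-- A₁ + A₂ = N (q₁ + q₂), so ker N* = ker N ⊕ ⟨q₁ + q₂⟩.
module Submission where

open import Defs
open import Data.Nat using (ℕ; zero; suc)
open import Data.Fin using (Fin; zero; suc; _≟_)
open import Data.Bool using (Bool; true; false; _∧_; _∨_; _xor_)
open import Data.Bool.Properties
  using (∧-comm; ∧-assoc; ∧-idem; ∧-identityʳ; ∧-zeroʳ; ∧-distribˡ-xor; ∧-distribʳ-xor;
         xor-comm; xor-identityʳ; xor-same)
open import Data.Bool.Solver using (module xor-∧-Solver)
open import Data.Vec.Functional using (_∷_; tail)
open import Data.Product using (Σ; _×_; _,_)
open import Data.Sum using (_⊎_; inj₁; inj₂)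
open import Data.Empty using (⊥-elim)
open import Function.Bundles using (_⇔_; mk⇔)
open import Relation.Nullary using (¬_; yes; no)
open import Relation.Binary.PropositionalEquality
  using (_≡_; _≢_; refl; sym; trans; cong; cong₂; module ≡-Reasoning)

open xor-∧-Solver using (solve; _:=_; _:+_; _:*_)

xor-interchange : ∀ a b c d → (a xor b) xor (c xor d) ≡ (a xor c) xor (b xor d)
xor-interchange = solve 4 (λ a b c d → (a :+ b) :+ (c :+ d) := (a :+ c) :+ (b :+ d)) refl

xor-cancelˡ-middle : ∀ a b c → (a xor b) xor (b xor c) ≡ a xor c
xor-cancelˡ-middle = solve 3 (λ a b c → (a :+ b) :+ (b :+ c) := a :+ c) refl

xor-xor-cancel : ∀ a b → (a xor b) xor b ≡ a
xor-xor-cancel = solve 2 (λ a b → (a :+ b) :+ b := a) refl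

∧-left-comm : ∀ a b c → a ∧ (b ∧ c) ≡ b ∧ (a ∧ c)
∧-left-comm = solve 3 (λ a b c → a :* (b :* c) := b :* (a :* c)) refl

∧-outer-comm : ∀ a b c → a ∧ (b ∧ c) ≡ c ∧ (b ∧ a)
∧-outer-comm = solve 3 (λ a b c → a :* (b :* c) := c :* (b :* a)) refl

xor-cancelʳ : ∀ {a b} c → a xor c ≡ b xor c → a ≡ b
xor-cancelʳ {a} {b} c h = begin
  a                ≡⟨ sym (xor-xor-cancel a c) ⟩
  (a xor c) xor c  ≡⟨ cong (_xor c) h ⟩
  (b xor c) xor c  ≡⟨ xor-xor-cancel b c ⟩
  b                ∎
  where open ≡-Reasoning

xor≡false⇒≡ : ∀ {a b} → a xor b ≡ false → a ≡ b
xor≡false⇒≡ {b = b} h = xor-cancelʳ b (trans h (sym (xor-same b)))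

∧-interchange : ∀ a b c d → (a ∧ b) ∧ (c ∧ d) ≡ (a ∧ c) ∧ (b ∧ d)
∧-interchange = solve 4 (λ a b c d → (a :* b) :* (c :* d) := (a :* c) :* (b :* d)) refl

∨≡xor : ∀ a b → a ∧ b ≡ false → a ∨ b ≡ a xor b
∨≡xor false b     _ = refl
∨≡xor true  false _ = refl
∨≡xor true  true  ()

true≢false : true ≢ false
true≢false ()

Σ₂-cong : ∀ {n} {f g : Fin n → Bool} → (∀ i → f i ≡ g i) → Σ₂ f ≡ Σ₂ g
Σ₂-cong {zero}  h = refl
Σ₂-cong {suc n} h = cong₂ _xor_ (h zero) (Σ₂-cong (λ i → h (suc i)))

Σ₂-false : ∀ {n} → Σ₂ {n} (λ _ → false) ≡ false
Σ₂-false {zero}  = refl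
Σ₂-false {suc n} = Σ₂-false {n}

Σ₂-xor : ∀ {n} (f g : Fin n → Bool) → Σ₂ (λ i → f i xor g i) ≡ Σ₂ f xor Σ₂ g
Σ₂-xor {zero}  f g = refl
Σ₂-xor {suc n} f g =
  trans (cong ((f zero xor g zero) xor_) (Σ₂-xor (λ i → f (suc i)) (λ i → g (suc i))))
        (xor-interchange (f zero) (g zero) _ _)

Σ₂-∧ˡ : ∀ {n} a (f : Fin n → Bool) → Σ₂ (λ i → a ∧ f i) ≡ a ∧ Σ₂ f
Σ₂-∧ˡ {zero}  a f = sym (∧-zeroʳ a)
Σ₂-∧ˡ {suc n} a f =
  trans (cong ((a ∧ f zero) xor_) (Σ₂-∧ˡ a (λ i → f (suc i))))
        (sym (∧-distribˡ-xor a (f zero) _))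

Σ₂-swap : ∀ {m n} (f : Fin m → Fin n → Bool) →
          Σ₂ (λ i → Σ₂ (λ j → f i j)) ≡ Σ₂ (λ j → Σ₂ (λ i → f i j))
Σ₂-swap {zero}  {n} f = sym (Σ₂-false {n})
Σ₂-swap {suc m} f =
  trans (cong (Σ₂ (f zero) xor_) (Σ₂-swap (λ i → f (suc i))))
        (sym (Σ₂-xor (f zero) (λ j → Σ₂ (λ i → f (suc i) j))))

Σ₂-symmetric : ∀ {n} (f : Fin n → Fin n → Bool) → (∀ i j → f i j ≡ f j i) →
               Σ₂ (λ i → Σ₂ (λ j → f i j)) ≡ Σ₂ (λ i → f i i)
Σ₂-symmetric {zero}  f f-sym = refl
Σ₂-symmetric {suc n} f f-sym = begin
  (f zero zero xor row) xor Σ₂ (λ i → f (suc i) zero xor Σ₂ (λ j → f (suc i) (suc j)))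
    ≡⟨ cong ((f zero zero xor row) xor_) (Σ₂-xor (λ i → f (suc i) zero) _) ⟩
  (f zero zero xor row) xor (Σ₂ (λ i → f (suc i) zero) xor Σ₂ (λ i → Σ₂ (λ j → f (suc i) (suc j))))
    ≡⟨ cong ((f zero zero xor row) xor_)
         (cong₂ _xor_ (Σ₂-cong (λ i → f-sym (suc i) zero))
                      (Σ₂-symmetric (λ i j → f (suc i) (suc j)) (λ i j → f-sym (suc i) (suc j)))) ⟩
  (f zero zero xor row) xor (row xor Σ₂ (λ i → f (suc i) (suc i)))
    ≡⟨ xor-cancelˡ-middle (f zero zero) row _ ⟩
  f zero zero xor Σ₂ (λ i → f (suc i) (suc i))
    ∎
  where
  open ≡-Reasoning
  row : Bool
  row = Σ₂ (λ j → f zero (suc j))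

infixl 21 _⊕_
infixr 22 _⊛_

_⊕_ : ∀ {n} → Vec₂ n → Vec₂ n → Vec₂ n
(x ⊕ y) i = x i xor y i

_⊛_ : ∀ {n} → Bool → Vec₂ n → Vec₂ n
(a ⊛ x) i = a ∧ x i

≈-sym : ∀ {n} {x y : Vec₂ n} → x ≈ y → y ≈ x
≈-sym h i = sym (h i)

≈-trans : ∀ {n} {x y z : Vec₂ n} → x ≈ y → y ≈ z → x ≈ z
≈-trans h h′ i = trans (h i) (h′ i)

⊕-self : ∀ {n} (x : Vec₂ n) → x ⊕ x ≈ 𝟎
⊕-self x i = xor-same (x i)

⊕-moveʳ : ∀ {n} {x y z : Vec₂ n} → x ⊕ y ≈ z → x ≈ z ⊕ y
⊕-moveʳ {x = x} {y} h i = trans (sym (xor-xor-cancel (x i) (y i))) (cong (_xor y i) (h i))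

⊛-distribˡ-⊕ : ∀ {n} a (x y : Vec₂ n) → a ⊛ (x ⊕ y) ≈ a ⊛ x ⊕ a ⊛ y
⊛-distribˡ-⊕ a x y i = ∧-distribˡ-xor a (x i) (y i)

‾-⊕-self : ∀ {n} (x : Vec₂ n) → ‾ x ⊕ x ≈ 𝟏
‾-⊕-self x i with x i
... | false = refl
... | true  = refl

·-comm : ∀ {n} (x y : Vec₂ n) → x · y ≡ y · x
·-comm x y = Σ₂-cong (λ i → ∧-comm (x i) (y i))

·-congˡ : ∀ {n} {x x′ : Vec₂ n} (y : Vec₂ n) → x ≈ x′ → x · y ≡ x′ · y
·-congˡ y h = Σ₂-cong (λ i → cong (_∧ y i) (h i))

·-congʳ : ∀ {n} (x : Vec₂ n) {y y′ : Vec₂ n} → y ≈ y′ → x · y ≡ x · y′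
·-congʳ x h = Σ₂-cong (λ i → cong (x i ∧_) (h i))

·-zeroʳ : ∀ {n} (x : Vec₂ n) → x · 𝟎 ≡ false
·-zeroʳ {n} x = trans (Σ₂-cong (λ i → ∧-zeroʳ (x i))) (Σ₂-false {n})

·-distribˡ-⊕ : ∀ {n} (x y z : Vec₂ n) → x · (y ⊕ z) ≡ x · y xor x · z
·-distribˡ-⊕ x y z =
  trans (Σ₂-cong (λ i → ∧-distribˡ-xor (x i) (y i) (z i))) (Σ₂-xor (λ i → x i ∧ y i) _)

·-distribʳ-⊕ : ∀ {n} (x y z : Vec₂ n) → (x ⊕ y) · z ≡ x · z xor y · z
·-distribʳ-⊕ x y z =
  trans (Σ₂-cong (λ i → ∧-distribʳ-xor (z i) (x i) (y i))) (Σ₂-xor (λ i → x i ∧ z i) _)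

·-⊛ˡ : ∀ {n} a (x y : Vec₂ n) → (a ⊛ x) · y ≡ a ∧ x · y
·-⊛ˡ a x y = trans (Σ₂-cong (λ i → ∧-assoc a (x i) (y i))) (Σ₂-∧ˡ a (λ i → x i ∧ y i))

·-⊛ʳ : ∀ {n} a (x y : Vec₂ n) → x · (a ⊛ y) ≡ a ∧ x · y
·-⊛ʳ a x y = trans (Σ₂-cong (λ i → ∧-left-comm (x i) a (y i))) (Σ₂-∧ˡ a (λ i → x i ∧ y i))

*ᵥ-congʳ : ∀ {n} (M : Mat₂ n) {x y : Vec₂ n} → x ≈ y → (M *ᵥ x) ≈ (M *ᵥ y)
*ᵥ-congʳ M h i = ·-congʳ (M i) h

*ᵥ-zeroʳ : ∀ {n} (M : Mat₂ n) → (M *ᵥ 𝟎) ≈ 𝟎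
*ᵥ-zeroʳ M i = ·-zeroʳ (M i)

*ᵥ-distribˡ-⊕ : ∀ {n} (M : Mat₂ n) (x y : Vec₂ n) → (M *ᵥ (x ⊕ y)) ≈ (M *ᵥ x) ⊕ (M *ᵥ y)
*ᵥ-distribˡ-⊕ M x y i = ·-distribˡ-⊕ (M i) x y

*ᵥ-⊛ : ∀ {n} (M : Mat₂ n) a (x : Vec₂ n) → (M *ᵥ (a ⊛ x)) ≈ a ⊛ (M *ᵥ x)
*ᵥ-⊛ M a x i = ·-⊛ʳ a (M i) x

InKer-lincomb : ∀ {n k} {M : Mat₂ n} {b : Fin k → Vec₂ n} →
                (∀ j → InKer M (b j)) → ∀ c → InKer M (lincomb c b)
InKer-lincomb {k = zero}  {M} b-ker c = *ᵥ-zeroʳ M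
InKer-lincomb {k = suc k} {M} {b} b-ker c i = begin
  (M *ᵥ lincomb c b) i
    ≡⟨ *ᵥ-distribˡ-⊕ M (c zero ⊛ b zero) (lincomb (tail c) (tail b)) i ⟩
  (M *ᵥ (c zero ⊛ b zero)) i xor (M *ᵥ lincomb (tail c) (tail b)) i
    ≡⟨ cong₂ _xor_ (trans (*ᵥ-⊛ M (c zero) (b zero) i) (cong (c zero ∧_) (b-ker zero i)))
                   (InKer-lincomb (λ j → b-ker (suc j)) (tail c) i) ⟩
  (c zero ∧ false) xor false
    ≡⟨ cong (_xor false) (∧-zeroʳ (c zero)) ⟩
  false
    ∎
  where open ≡-Reasoning

IsKerBasis-∷ : ∀ {n k} {M M′ : Mat₂ n} {u : Vec₂ n} {b : Fin k → Vec₂ n} →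
  IsKerBasis M k b → InKer M′ u → ¬ InKer M u →
  (∀ x → InKer M x → InKer M′ x) →
  (∀ x → InKer M′ x → Σ Bool λ a → InKer M (x ⊕ a ⊛ u)) →
  IsKerBasis M′ (suc k) (u ∷ b)
IsKerBasis-∷ {k = k} {M} {M′} {u} {b} (b-ker , b-indep , b-span) u-ker′ u∉ker ker⊆ker′ reduce =
  ker′ , indep , span
  where
  ker′ : ∀ j → InKer M′ ((u ∷ b) j)
  ker′ zero    = u-ker′
  ker′ (suc j) = ker⊆ker′ (b j) (b-ker j)

  head-false : ∀ a {v} → InKer M v → a ⊛ u ⊕ v ≈ 𝟎 → a ≡ false
  head-false false _     _ = refl
  head-false true  v-ker h =
    ⊥-elim (u∉ker (≈-trans (*ᵥ-congʳ M (λ i → xor≡false⇒≡ (h i))) v-ker))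

  indep : ∀ c → lincomb c (u ∷ b) ≈ 𝟎 → ∀ j → c j ≡ false
  indep c h zero    = head-false (c zero) (InKer-lincomb b-ker (tail c)) h
  indep c h (suc j) = b-indep (tail c) tail-indep j
    where
    tail-indep : lincomb (tail c) b ≈ 𝟎
    tail-indep i = trans (cong (λ a → (a ∧ u i) xor lincomb (tail c) b i) (sym (indep c h zero))) (h i)

  span : ∀ x → InKer M′ x → Σ (Fin (suc k) → Bool) λ c → lincomb c (u ∷ b) ≈ x
  span x x-ker′ with reduce x x-ker′
  ... | a , y-ker with b-span (x ⊕ a ⊛ u) y-ker
  ...   | c , c-spans = a ∷ c , λ i →
    trans (cong ((a ∧ u i) xor_) (c-spans i)) (trans (xor-comm (a ∧ u i) _) (xor-xor-cancel (x i) (a ∧ u i)))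

IsSymmetric : ∀ {n} → Mat₂ n → Set
IsSymmetric M = ∀ i j → M i j ≡ M j i

HasUnitDiagonal : ∀ {n} → Mat₂ n → Set
HasUnitDiagonal M = ∀ i → M i i ≡ true

module _ {n} {M : Mat₂ n} (M-sym : IsSymmetric M) where

  *ᵥ-selfAdjoint : ∀ (x y : Vec₂ n) → (M *ᵥ x) · y ≡ x · (M *ᵥ y)
  *ᵥ-selfAdjoint x y = begin
    Σ₂ (λ i → (M *ᵥ x) i ∧ y i)                ≡⟨ Σ₂-cong (λ i → ∧-comm _ (y i)) ⟩
    Σ₂ (λ i → y i ∧ (M *ᵥ x) i)                ≡˘⟨ Σ₂-cong (λ i → Σ₂-∧ˡ (y i) (λ j → M i j ∧ x j)) ⟩
    Σ₂ (λ i → Σ₂ (λ j → y i ∧ (M i j ∧ x j)))  ≡⟨ Σ₂-swap (λ i j → y i ∧ (M i j ∧ x j)) ⟩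
    Σ₂ (λ j → Σ₂ (λ i → y i ∧ (M i j ∧ x j)))  ≡⟨ Σ₂-cong (λ j → Σ₂-cong (λ i → transpose i j)) ⟩
    Σ₂ (λ j → Σ₂ (λ i → x j ∧ (M j i ∧ y i)))  ≡⟨ Σ₂-cong (λ j → Σ₂-∧ˡ (x j) (λ i → M j i ∧ y i)) ⟩
    x · (M *ᵥ y)                               ∎
    where
    open ≡-Reasoning
    transpose : ∀ i j → y i ∧ (M i j ∧ x j) ≡ x j ∧ (M j i ∧ y i)
    transpose i j = trans (∧-outer-comm (y i) (M i j) (x j)) (cong (λ m → x j ∧ (m ∧ y i)) (M-sym i j))

  solves-dual : ∀ {p c q a : Vec₂ n} → Solves M p c → Solves M q a → a · p ≡ q · c
  solves-dual {p} {c} {q} {a} p-solves q-solves = begin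
    a · p             ≡˘⟨ ·-congˡ p q-solves ⟩
    (M *ᵥ q) · p      ≡⟨ *ᵥ-selfAdjoint q p ⟩
    q · (M *ᵥ p)      ≡⟨ ·-congʳ q p-solves ⟩
    q · c             ∎
    where open ≡-Reasoning

  ·-*ᵥ-self : HasUnitDiagonal M → ∀ (x : Vec₂ n) → x · (M *ᵥ x) ≡ x · 𝟏
  ·-*ᵥ-self M-diag x = begin
    Σ₂ (λ i → x i ∧ (M *ᵥ x) i)                ≡˘⟨ Σ₂-cong (λ i → Σ₂-∧ˡ (x i) (λ j → M i j ∧ x j)) ⟩
    Σ₂ (λ i → Σ₂ (λ j → x i ∧ (M i j ∧ x j)))  ≡⟨ Σ₂-symmetric _ symmetric ⟩
    Σ₂ (λ i → x i ∧ (M i i ∧ x i))             ≡⟨ Σ₂-cong diagonal ⟩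
    x · 𝟏                                      ∎
    where
    open ≡-Reasoning
    symmetric : ∀ i j → x i ∧ (M i j ∧ x j) ≡ x j ∧ (M j i ∧ x i)
    symmetric i j = trans (∧-outer-comm (x i) (M i j) (x j)) (cong (λ m → x j ∧ (m ∧ x i)) (M-sym i j))
    diagonal : ∀ i → x i ∧ (M i i ∧ x i) ≡ x i ∧ true
    diagonal i rewrite M-diag i = trans (∧-idem (x i)) (sym (∧-identityʳ (x i)))

  ·-solution : HasUnitDiagonal M → ∀ {q a : Vec₂ n} → Solves M q a → q · a ≡ q · 𝟏
  ·-solution M-diag {q} q-solves = trans (sym (·-congʳ q q-solves)) (·-*ᵥ-self M-diag q)

  AO⇒·≡true : ∀ {q a c : Vec₂ n} → Solves M q a → (c -AO) M a → q · c ≡ true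
  AO⇒·≡true q-solves (_ , (p , p-solves) , a-AO) = trans (sym (solves-dual p-solves q-solves)) (a-AO p p-solves)

N-symmetric : ∀ {n} (G : Graph n) → IsSymmetric (N G)
N-symmetric G i j with i ≟ j | j ≟ i
... | yes _   | yes _   = refl
... | yes i≡j | no j≢i  = ⊥-elim (j≢i (sym i≡j))
... | no i≢j  | yes j≡i = ⊥-elim (i≢j (sym j≡i))
... | no _    | no _    = adj-sym G i j

N-unitDiagonal : ∀ {n} (G : Graph n) → HasUnitDiagonal (N G)
N-unitDiagonal G i with i ≟ i
... | yes _  = refl
... | no i≢i = ⊥-elim (i≢i refl)

module _ {n} (G : Graph n) (A₁ A₂ : Vec₂ n) (d : Disjoint A₁ A₂) where

  cross-self : ∀ i → (A₁ i ∧ A₂ i) xor (A₂ i ∧ A₁ i) ≡ false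
  cross-self i = trans (cong ((A₁ i ∧ A₂ i) xor_) (∧-comm (A₂ i) (A₁ i))) (xor-same (A₁ i ∧ A₂ i))

  cross≡xor : ∀ i j → cross A₁ A₂ i j ≡ (A₁ i ∧ A₂ j) xor (A₂ i ∧ A₁ j)
  cross≡xor i j = ∨≡xor (A₁ i ∧ A₂ j) (A₂ i ∧ A₁ j)
    (trans (∧-interchange (A₁ i) (A₂ j) (A₂ i) (A₁ j)) (cong (_∧ (A₂ j ∧ A₁ j)) (d i)))

  N-toggle-row : ∀ i → N (toggle G A₁ A₂ d) i ≈ N G i ⊕ (A₁ i ⊛ A₂ ⊕ A₂ i ⊛ A₁)
  N-toggle-row i j with i ≟ j
  ... | yes refl = cong (true xor_) (sym (cross-self i))
  ... | no _     = cong (adj G i j xor_) (cross≡xor i j)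

  N-toggle : ∀ p → (N (toggle G A₁ A₂ d) *ᵥ p) ≈ (N G *ᵥ p) ⊕ ((A₂ · p) ⊛ A₁ ⊕ (A₁ · p) ⊛ A₂)
  N-toggle p i = begin
    N (toggle G A₁ A₂ d) i · p                         ≡⟨ ·-congˡ p (N-toggle-row i) ⟩
    (N G i ⊕ (A₁ i ⊛ A₂ ⊕ A₂ i ⊛ A₁)) · p              ≡⟨ ·-distribʳ-⊕ (N G i) _ p ⟩
    N G i · p xor (A₁ i ⊛ A₂ ⊕ A₂ i ⊛ A₁) · p          ≡⟨ cong (N G i · p xor_) (·-distribʳ-⊕ (A₁ i ⊛ A₂) _ p) ⟩
    N G i · p xor ((A₁ i ⊛ A₂) · p xor (A₂ i ⊛ A₁) · p) ≡⟨ cong (N G i · p xor_) (cong₂ _xor_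
                                                            (trans (·-⊛ˡ (A₁ i) A₂ p) (∧-comm (A₁ i) _))
                                                            (trans (·-⊛ˡ (A₂ i) A₁ p) (∧-comm (A₂ i) _))) ⟩
    N G i · p xor ((A₂ · p) ∧ A₁ i xor (A₁ · p) ∧ A₂ i) ∎
    where open ≡-Reasoning

module DualSolutions
  {n} {M M* : Mat₂ n} (M-sym : IsSymmetric M) (M-diag : HasUnitDiagonal M)
  {A₁ A₂ : Vec₂ n} (M*-update : ∀ p → (M* *ᵥ p) ≈ (M *ᵥ p) ⊕ ((A₂ · p) ⊛ A₁ ⊕ (A₁ · p) ⊛ A₂))
  {q₁ q₂ : Vec₂ n} (q₁-solves : Solves M q₁ A₁) (q₂-solves : Solves M q₂ A₂)
  (q₁·A₁≡true : q₁ · A₁ ≡ true) (q₁·A₂≡false : q₁ · A₂ ≡ false)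
  (q₂·A₁≡false : q₂ · A₁ ≡ false) (q₂·A₂≡true : q₂ · A₂ ≡ true)
  where

  q₁·combination : ∀ a b → q₁ · (a ⊛ A₁ ⊕ b ⊛ A₂) ≡ a
  q₁·combination a b = begin
    q₁ · (a ⊛ A₁ ⊕ b ⊛ A₂)        ≡⟨ ·-distribˡ-⊕ q₁ (a ⊛ A₁) (b ⊛ A₂) ⟩
    q₁ · (a ⊛ A₁) xor q₁ · (b ⊛ A₂) ≡⟨ cong₂ _xor_ (·-⊛ʳ a q₁ A₁) (·-⊛ʳ b q₁ A₂) ⟩
    a ∧ q₁ · A₁ xor b ∧ q₁ · A₂    ≡⟨ cong₂ (λ s t → a ∧ s xor b ∧ t) q₁·A₁≡true q₁·A₂≡false ⟩
    a ∧ true xor b ∧ false         ≡⟨ cong₂ _xor_ (∧-identityʳ a) (∧-zeroʳ b) ⟩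
    a xor false                    ≡⟨ xor-identityʳ a ⟩
    a                              ∎
    where open ≡-Reasoning

  q₂·combination : ∀ a b → q₂ · (a ⊛ A₁ ⊕ b ⊛ A₂) ≡ b
  q₂·combination a b = begin
    q₂ · (a ⊛ A₁ ⊕ b ⊛ A₂)        ≡⟨ ·-distribˡ-⊕ q₂ (a ⊛ A₁) (b ⊛ A₂) ⟩
    q₂ · (a ⊛ A₁) xor q₂ · (b ⊛ A₂) ≡⟨ cong₂ _xor_ (·-⊛ʳ a q₂ A₁) (·-⊛ʳ b q₂ A₂) ⟩
    a ∧ q₂ · A₁ xor b ∧ q₂ · A₂    ≡⟨ cong₂ (λ s t → a ∧ s xor b ∧ t) q₂·A₁≡false q₂·A₂≡true ⟩
    a ∧ false xor b ∧ true         ≡⟨ cong₂ _xor_ (∧-zeroʳ a) (∧-identityʳ b) ⟩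
    b                              ∎
    where open ≡-Reasoning

  q₁·𝟏≡true : q₁ · 𝟏 ≡ true
  q₁·𝟏≡true = trans (sym (·-solution M-sym M-diag q₁-solves)) q₁·A₁≡true

  q₂·𝟏≡true : q₂ · 𝟏 ≡ true
  q₂·𝟏≡true = trans (sym (·-solution M-sym M-diag q₂-solves)) q₂·A₂≡true

  correction : Vec₂ n → Vec₂ n
  correction c = (q₂ · c) ⊛ A₁ ⊕ (q₁ · c) ⊛ A₂

  update : Vec₂ n → Vec₂ n
  update c = c ⊕ correction c

  update-at : ∀ {c a b} → q₂ · c ≡ a → q₁ · c ≡ b → update c ≈ c ⊕ (a ⊛ A₁ ⊕ b ⊛ A₂)
  update-at refl refl i = refl

  update-cong : ∀ {c c′} → c ≈ c′ → update c ≈ update c′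
  update-cong h = ≈-trans (update-at (·-congʳ q₂ h) (·-congʳ q₁ h)) (λ i → cong (_xor _) (h i))

  M*-factor : ∀ p → (M* *ᵥ p) ≈ update (M *ᵥ p)
  M*-factor p = ≈-trans (M*-update p)
    (≈-sym (update-at (sym (solves-dual M-sym (λ _ → refl) q₂-solves))
                      (sym (solves-dual M-sym (λ _ → refl) q₁-solves))))

  q₁·update : ∀ c → q₁ · update c ≡ q₁ · c xor q₂ · c
  q₁·update c = trans (·-distribˡ-⊕ q₁ c (correction c))
                      (cong (q₁ · c xor_) (q₁·combination (q₂ · c) (q₁ · c)))

  q₂·update : ∀ c → q₂ · update c ≡ q₁ · c xor q₂ · c
  q₂·update c = trans (·-distribˡ-⊕ q₂ c (correction c))
                      (trans (cong (q₂ · c xor_) (q₂·combination (q₂ · c) (q₁ · c))) (xor-comm (q₂ · c) (q₁ · c)))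

  update-dual : ∀ {c w} → update c ≈ w → q₁ · w ≡ q₂ · w
  update-dual {c} {w} h = begin
    q₁ · w             ≡˘⟨ ·-congʳ q₁ h ⟩
    q₁ · update c      ≡⟨ q₁·update c ⟩
    q₁ · c xor q₂ · c  ≡˘⟨ q₂·update c ⟩
    q₂ · update c      ≡⟨ ·-congʳ q₂ h ⟩
    q₂ · w             ∎
    where open ≡-Reasoning

  update≈𝟏 : ∀ {c} → update c ≈ 𝟏 → c ≈ ‾ A₁ ⊎ c ≈ ‾ A₂
  update≈𝟏 {c} h = cases (q₂ · c) (q₁ · c) (trans (sym (q₁·update c)) (trans (·-congʳ q₁ h) q₁·𝟏≡true))
                         (⊕-moveʳ h)
    where
    cases : ∀ a b → b xor a ≡ true → c ≈ 𝟏 ⊕ (a ⊛ A₁ ⊕ b ⊛ A₂) → c ≈ ‾ A₁ ⊎ c ≈ ‾ A₂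
    cases true  false _ c≈ = inj₁ λ i → trans (c≈ i) (trans (cong (true xor_) (xor-identityʳ (A₁ i)))
                                                            (xor-comm true (A₁ i)))
    cases false true  _ c≈ = inj₂ λ i → trans (c≈ i) (xor-comm true (A₂ i))

  update-‾A₁ : update (‾ A₁) ≈ 𝟏
  update-‾A₁ = ≈-trans (update-at q₂·‾A₁ q₁·‾A₁)
                       (λ i → trans (cong (‾ A₁ i xor_) (xor-identityʳ (A₁ i))) (‾-⊕-self A₁ i))
    where
    q₂·‾A₁ : q₂ · ‾ A₁ ≡ true
    q₂·‾A₁ = trans (·-distribˡ-⊕ q₂ A₁ 𝟏) (cong₂ _xor_ q₂·A₁≡false q₂·𝟏≡true)
    q₁·‾A₁ : q₁ · ‾ A₁ ≡ false
    q₁·‾A₁ = trans (·-distribˡ-⊕ q₁ A₁ 𝟏) (cong₂ _xor_ q₁·A₁≡true q₁·𝟏≡true)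

  update-‾A₂ : update (‾ A₂) ≈ 𝟏
  update-‾A₂ = ≈-trans (update-at q₂·‾A₂ q₁·‾A₂) (‾-⊕-self A₂)
    where
    q₂·‾A₂ : q₂ · ‾ A₂ ≡ false
    q₂·‾A₂ = trans (·-distribˡ-⊕ q₂ A₂ 𝟏) (cong₂ _xor_ q₂·A₂≡true q₂·𝟏≡true)
    q₁·‾A₂ : q₁ · ‾ A₂ ≡ true
    q₁·‾A₂ = trans (·-distribˡ-⊕ q₁ A₂ 𝟏) (cong₂ _xor_ q₁·A₂≡false q₁·𝟏≡true)

  update-𝟎 : update 𝟎 ≈ 𝟎
  update-𝟎 = update-at (·-zeroʳ q₂) (·-zeroʳ q₁)

  update-A₁⊕A₂ : update (A₁ ⊕ A₂) ≈ 𝟎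
  update-A₁⊕A₂ = ≈-trans (update-at (q₂·combination true true) (q₁·combination true true)) (⊕-self (A₁ ⊕ A₂))

  update≈𝟎 : ∀ {c} → update c ≈ 𝟎 → c ≈ (q₁ · c) ⊛ (A₁ ⊕ A₂)
  update≈𝟎 {c} h i = begin
    c i                                          ≡⟨ ⊕-moveʳ {x = c} h i ⟩
    (q₂ · c) ∧ A₁ i xor (q₁ · c) ∧ A₂ i          ≡˘⟨ cong (λ a → a ∧ A₁ i xor (q₁ · c) ∧ A₂ i) q₁≡q₂ ⟩
    (q₁ · c) ∧ A₁ i xor (q₁ · c) ∧ A₂ i          ≡˘⟨ ⊛-distribˡ-⊕ (q₁ · c) A₁ A₂ i ⟩
    (q₁ · c) ∧ (A₁ i xor A₂ i)                   ∎
    where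
    open ≡-Reasoning
    q₁≡q₂ : q₁ · c ≡ q₂ · c
    q₁≡q₂ = xor≡false⇒≡ (trans (sym (q₁·update c)) (trans (·-congʳ q₁ h) (·-zeroʳ q₁)))

  solves-𝟏 : ∀ p → Solves M* p 𝟏 ⇔ (Solves M p (‾ A₁) ⊎ Solves M p (‾ A₂))
  solves-𝟏 p = mk⇔ (λ h → update≈𝟏 {M *ᵥ p} (≈-trans (≈-sym (M*-factor p)) h)) from
    where
    from : Solves M p (‾ A₁) ⊎ Solves M p (‾ A₂) → Solves M* p 𝟏
    from (inj₁ h) = ≈-trans (M*-factor p) (≈-trans (update-cong h) update-‾A₁)
    from (inj₂ h) = ≈-trans (M*-factor p) (≈-trans (update-cong h) update-‾A₂)

  HO-if-separated : ∀ {w} → q₁ · w ≢ q₂ · w → HO M* w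
  HO-if-separated w-sep (p , h) = w-sep (update-dual {M *ᵥ p} (≈-trans (≈-sym (M*-factor p)) h))

  HO-A₁ : HO M* A₁
  HO-A₁ = HO-if-separated λ e → true≢false (trans (sym q₁·A₁≡true) (trans e q₂·A₁≡false))

  HO-A₂ : HO M* A₂
  HO-A₂ = HO-if-separated λ e → true≢false (trans (sym q₂·A₂≡true) (trans (sym e) q₁·A₂≡false))

  u : Vec₂ n
  u = q₁ ⊕ q₂

  u-solves : Solves M u (A₁ ⊕ A₂)
  u-solves = ≈-trans (*ᵥ-distribˡ-⊕ M q₁ q₂) (λ i → cong₂ _xor_ (q₁-solves i) (q₂-solves i))

  u∈ker* : InKer M* u
  u∈ker* = ≈-trans (M*-factor u) (≈-trans (update-cong u-solves) update-A₁⊕A₂)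

  u∉ker : ¬ InKer M u
  u∉ker u∈ker = true≢false (begin
    true               ≡˘⟨ q₁·combination true true ⟩
    q₁ · (A₁ ⊕ A₂)     ≡⟨ ·-congʳ q₁ (≈-trans (≈-sym u-solves) u∈ker) ⟩
    q₁ · 𝟎             ≡⟨ ·-zeroʳ q₁ ⟩
    false              ∎)
    where open ≡-Reasoning

  ker⊆ker* : ∀ x → InKer M x → InKer M* x
  ker⊆ker* x x∈ker = ≈-trans (M*-factor x) (≈-trans (update-cong x∈ker) update-𝟎)

  ker*-reduce : ∀ x → InKer M* x → Σ Bool λ a → InKer M (x ⊕ a ⊛ u)
  ker*-reduce x x∈ker* = a , λ i → begin
    (M *ᵥ (x ⊕ a ⊛ u)) i                       ≡⟨ *ᵥ-distribˡ-⊕ M x (a ⊛ u) i ⟩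
    (M *ᵥ x) i xor (M *ᵥ (a ⊛ u)) i             ≡⟨ cong₂ _xor_ (Mx i) (trans (*ᵥ-⊛ M a u i)
                                                                        (cong (a ∧_) (u-solves i))) ⟩
    (a ⊛ (A₁ ⊕ A₂)) i xor (a ⊛ (A₁ ⊕ A₂)) i     ≡⟨ xor-same ((a ⊛ (A₁ ⊕ A₂)) i) ⟩
    false                                      ∎
    where
    open ≡-Reasoning
    a : Bool
    a = q₁ · (M *ᵥ x)
    Mx : (M *ᵥ x) ≈ a ⊛ (A₁ ⊕ A₂)
    Mx = update≈𝟎 (≈-trans (≈-sym (M*-factor x)) x∈ker*)

  nullity-suc : ∀ k → HasNullity M k → HasNullity M* (suc k)
  nullity-suc k (b , b-basis) = u ∷ b , IsKerBasis-∷ b-basis u∈ker* u∉ker ker⊆ker* ker*-reduce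

mainTheorem14 : ∀ {n} (G : Graph n) (A₁ A₂ : Vec₂ n) (d : Disjoint A₁ A₂) →
    AO (N G) A₁ → AO (N G) A₂ → ((‾ A₁) -AO) (N G) A₂ →
    ((∀ (p : Vec₂ n) → Solves (N (toggle G A₁ A₂ d)) p 𝟏 ⇔ (Solves (N G) p (‾ A₁) ⊎ Solves (N G) p (‾ A₂)))
     × HO (N (toggle G A₁ A₂ d)) A₁
     × HO (N (toggle G A₁ A₂ d)) A₂
     × (∀ (k : ℕ) → HasNullity (N G) k → HasNullity (N (toggle G A₁ A₂ d)) (suc k)))
mainTheorem14 G A₁ A₂ d A₁-AO@((q₁ , q₁-solves) , _) A₂-AO@((q₂ , q₂-solves) , _) A₂-‾A₁-AO =
  solves-𝟏 , HO-A₁ , HO-A₂ , nullity-suc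
  where
  sym-N : IsSymmetric (N G)
  sym-N = N-symmetric G

  diag-N : HasUnitDiagonal (N G)
  diag-N = N-unitDiagonal G

  q₁·A₁≡true : q₁ · A₁ ≡ true
  q₁·A₁≡true = trans (·-solution sym-N diag-N q₁-solves) (AO⇒·≡true sym-N q₁-solves A₁-AO)

  q₂·A₂≡true : q₂ · A₂ ≡ true
  q₂·A₂≡true = trans (·-solution sym-N diag-N q₂-solves) (AO⇒·≡true sym-N q₂-solves A₂-AO)

  q₂·A₁≡false : q₂ · A₁ ≡ false
  q₂·A₁≡false = xor-cancelʳ true (begin
    q₂ · A₁ xor true     ≡˘⟨ cong (q₂ · A₁ xor_) (AO⇒·≡true sym-N q₂-solves A₂-AO) ⟩
    q₂ · A₁ xor q₂ · 𝟏   ≡˘⟨ ·-distribˡ-⊕ q₂ A₁ 𝟏 ⟩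
    q₂ · ‾ A₁            ≡⟨ AO⇒·≡true sym-N q₂-solves A₂-‾A₁-AO ⟩
    true                 ∎)
    where open ≡-Reasoning

  q₁·A₂≡false : q₁ · A₂ ≡ false
  q₁·A₂≡false = trans (·-comm q₁ A₂) (trans (solves-dual sym-N q₁-solves q₂-solves) q₂·A₁≡false)

  open DualSolutions sym-N diag-N (N-toggle G A₁ A₂ d) q₁-solves q₂-solves
                     q₁·A₁≡true q₁·A₂≡false q₂·A₁≡false q₂·A₂≡true
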